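{- Let $G$ be an Eulerian multigraph (finite, without loops) which is interval colorable. Then for every edge $e\in E(G)$, the multigraph $G_e$ is not interval colorable.
   Context: A multigraph may have multiple edges but no loops; all multigraphs are finite. For an edge $e\in E(G)$, $G_e$ denotes the multigraph obtained from $G$ by subdividing the edge $e$ (replacing $e$ by a path of length two through a new vertex). A multigraph is Eulerian if it has a closed trail containing every edge. A proper edge-coloring of $G$ assigns colors to edges so that no two adjacent edges receive the same color. For a proper edge-coloring $\alpha$ and $v\in V(G)$, $S(v,\alpha)$ denotes the set of colors of edges incident to $v$. A proper edge-coloring of $G$ with colors $1,\ldots,t$ is an interval $t$-coloring if all colors $1,\ldots,t$ are used and for every vertex $v$ the set $S(v,\alpha)$ is an interval of consecutive integers. A multigraph is interval colorable if it has an interval $t$-coloring for some positive integer $t$. -}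

module Defs where

open import Data.Nat using (ℕ; zero; suc; _≤_; _<_)
open import Data.Fin using (Fin; zero; suc; inject₁; fromℕ; _≟_)
open import Data.Product using (_×_; _,_; proj₁; proj₂; Σ; ∃; ∃-syntax)
open import Data.Sum using (_⊎_)
open import Relation.Nullary using (¬_; yes; no)
open import Relation.Binary.PropositionalEquality using (_≡_; _≢_)
open import Function.Definitions using (Injective)

-- A finite multigraph: vertices Fin nV, edges Fin nE (edges are labelled,
-- so parallel edges are allowed); each edge has two endpoints.
record Multigraph : Set where
  field
    nV   : ℕ
    nE   : ℕ
    ends : Fin nE → Fin nV × Fin nV
open Multigraph public

Loopless : Multigraph → Set
Loopless G = ∀ (e : Fin (nE G)) → proj₁ (ends G e) ≢ proj₂ (ends G e)

Incident : (G : Multigraph) → Fin (nE G) → Fin (nV G) → Set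
Incident G e v = proj₁ (ends G e) ≡ v ⊎ proj₂ (ends G e) ≡ v

Joins : (G : Multigraph) → Fin (nE G) → Fin (nV G) → Fin (nV G) → Set
Joins G e x y = ends G e ≡ (x , y) ⊎ ends G e ≡ (y , x)

-- Eulerian: there is a closed trail containing every edge, i.e. an ordering
-- σ of all edges (injective on Fin nE, hence a bijection) and vertices
-- v₀,…,v_{nE} with v_{nE} = v₀ such that the i-th edge σ i joins v_i and v_{i+1}.
Eulerian : Multigraph → Set
Eulerian G =
  Σ (Fin (nE G) → Fin (nE G)) λ σ →
  Σ (Fin (suc (nE G)) → Fin (nV G)) λ v →
    Injective _≡_ _≡_ σ
    × v zero ≡ v (fromℕ (nE G))
    × (∀ i → Joins G (σ i) (v (inject₁ i)) (v (suc i)))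

Proper : (G : Multigraph) → (Fin (nE G) → ℕ) → Set
Proper G α = ∀ (e f : Fin (nE G)) (v : Fin (nV G)) →
  e ≢ f → Incident G e v → Incident G f v → α e ≢ α f

InS : (G : Multigraph) → (Fin (nE G) → ℕ) → Fin (nV G) → ℕ → Set
InS G α v c = ∃[ e ] (Incident G e v × α e ≡ c)

IsIntervalColoring : (G : Multigraph) → ℕ → (Fin (nE G) → ℕ) → Set
IsIntervalColoring G t α =
  Proper G α
  × (∀ e → 1 ≤ α e × α e ≤ t)
  × (∀ c → 1 ≤ c → c ≤ t → ∃[ e ] α e ≡ c)
  × (∀ v a b c → InS G α v a → InS G α v b → a ≤ c → c ≤ b → InS G α v c)

IntervalColorable : Multigraph → Set
IntervalColorable G =
  ∃[ t ] (1 ≤ t × ∃[ α ] IsIntervalColoring G t α)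

-- New vertex = zero (old vertex v becomes suc v);
-- new edge = zero, old edge i becomes suc i.
subdivide : (G : Multigraph) → Fin (nE G) → Multigraph
subdivide G e = record { nV = suc (nV G) ; nE = suc (nE G) ; ends = ends′ }
  where
    ends′ : Fin (suc (nE G)) → Fin (suc (nV G)) × Fin (suc (nV G))
    ends′ zero = zero , suc (proj₂ (ends G e))
    ends′ (suc i) with i ≟ e
    ... | yes _ = suc (proj₁ (ends G e)) , zero
    ... | no _  = suc (proj₁ (ends G i)) , suc (proj₂ (ends G i))

module Submission where

-- Key theorem: a loopless multigraph that has an interval colouring and in
-- which every vertex has even degree has an even number of edges.  At a
-- vertex v the colours of the incident edges are distinct and form an
-- interval; an interval of even length contains as many even as odd numbers,
-- so v sees as many even-coloured as odd-coloured edges.  Summing over all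
-- vertices counts every edge twice, hence there are as many even-coloured as
-- odd-coloured edges, and the number of edges is even.
--
-- An Eulerian multigraph G has all degrees even (a closed trail enters and
-- leaves a vertex equally often), and subdividing an edge keeps all degrees
-- even (the new vertex has degree 2) while adding one edge.  If G and G_e
-- were both interval colourable, |E(G)| and |E(G)| + 1 would both be even.

open import Defs
import Algebra.Properties.Semiring.Sum as Sums
open import Data.Bool using (true; false; if_then_else_)
open import Data.Fin using (Fin; zero; suc; toℕ; inject₁; fromℕ; punchOut)
import Data.Fin as Fin
open import Data.Fin.Permutation using (permutation)
open import Data.Fin.Properties using (any?; injective⇒≤; punchOut-injective; suc-injective)
open import Data.Nat using (ℕ; zero; suc; _+_; _*_; _≤_; _<_; z≤n; s≤s)
import Data.Nat as ℕ
open import Data.Nat.Divisibility using (_∣_; divides; ∣-refl; ∣1⇒≡1; ∣m+n∣m⇒∣n)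
open import Data.Nat.Properties
  using (+-*-semiring; ≤-refl; ≤-reflexive; ≤-trans; ≤-antisym; <-cmp; n≤1⇒n≡0∨n≡1;
         n≤0⇒n≡0; ≮⇒≥; n>0⇒n≢0; m≤n⇒m≤1+n; m≤m+n; m≤n+m; 1+n≰n; *-mono-≤;
         +-comm; +-suc; +-identityʳ; *-identityˡ; *-identityʳ; *-zeroʳ; *-comm; *-assoc;
         *-distribˡ-+; +-cancelˡ-≡; *-cancelˡ-≡)
open import Data.Product using (_×_; _,_; proj₁; proj₂; ∃; swap)
open import Data.Sum using (inj₁; inj₂)
open import Function using (_∘_)
open import Function.Definitions using (Injective)
open import Relation.Binary.Definitions using (DecidableEquality; tri<; tri≈; tri>)
open import Relation.Binary.PropositionalEquality
  using (_≡_; _≢_; refl; sym; trans; cong; cong₂; subst; subst₂; module ≡-Reasoning)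
open import Relation.Nullary using (¬_; yes; no; does)
open import Relation.Nullary.Decidable using (dec-true)
open import Relation.Nullary.Negation using (contradiction)

open Sums +-*-semiring
  using (sum; sum-syntax; ∑-distrib-+; ∑-comm; ∑-permute; sum-cong-≗; sum-init-last;
         sum-replicate-zero; *-distribˡ-sum; *-distribʳ-sum)
open ≡-Reasoning

module Indicator {A : Set} (_≟_ : DecidableEquality A) where

  δ : A → A → ℕ
  δ a b = if does (a ≟ b) then 1 else 0

  δ-refl : ∀ a → δ a a ≡ 1
  δ-refl a rewrite dec-true (a ≟ a) refl = refl

  δ-≤1 : ∀ a b → δ a b ≤ 1
  δ-≤1 a b with does (a ≟ b)
  ... | true  = ≤-refl
  ... | false = z≤n

  δ-pos⇒≡ : ∀ {a b} → 0 < δ a b → a ≡ b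
  δ-pos⇒≡ {a} {b} p with a ≟ b
  ... | yes a≡b = a≡b
  ... | no  _   = contradiction p λ ()

module FinIndicator {n : ℕ} = Indicator (Fin._≟_ {n})
open FinIndicator
open Indicator ℕ._≟_ using ()
  renaming (δ to δℕ; δ-refl to δℕ-refl; δ-≤1 to δℕ-≤1; δ-pos⇒≡ to δℕ-pos⇒≡)

∑-ones : ∀ n → ∑[ i < n ] 1 ≡ n
∑-ones zero    = refl
∑-ones (suc n) = cong suc (∑-ones n)

∑-zero : ∀ {n} {f : Fin n → ℕ} → (∀ i → f i ≡ 0) → sum f ≡ 0
∑-zero {n} f≡0 = trans (sum-cong-≗ {n} f≡0) (sum-replicate-zero n)

term≤∑ : ∀ {n} (f : Fin n → ℕ) i → f i ≤ sum f
term≤∑ f zero    = m≤m+n (f zero) _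
term≤∑ f (suc i) = ≤-trans (term≤∑ (f ∘ suc) i) (m≤n+m _ (f zero))

∑-pos : ∀ {n} (f : Fin n → ℕ) → 0 < sum f → ∃ λ i → 0 < f i
∑-pos {suc n} f p with f zero in f₀≡
... | zero  = let (i , fᵢ-pos) = ∑-pos (f ∘ suc) p in suc i , fᵢ-pos
... | suc _ = zero , ≤-trans (s≤s z≤n) (≤-reflexive (sym f₀≡))

∑≤1 : ∀ {n} (f : Fin n → ℕ) → (∀ i → f i ≤ 1) →
      (∀ i j → 0 < f i → 0 < f j → i ≡ j) → sum f ≤ 1
∑≤1 {zero}  f _   _      = z≤n
∑≤1 {suc n} f f≤1 unique with n≤1⇒n≡0∨n≡1 (f≤1 zero)
... | inj₁ f₀≡0 rewrite f₀≡0 =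
  ∑≤1 (f ∘ suc) (f≤1 ∘ suc) (λ i j p q → suc-injective (unique (suc i) (suc j) p q))
... | inj₂ f₀≡1 = ≤-reflexive (cong₂ _+_ f₀≡1 (∑-zero {n} rest≡0))
  where
    rest≡0 : ∀ i → f (suc i) ≡ 0
    rest≡0 i with n≤1⇒n≡0∨n≡1 (f≤1 (suc i))
    ... | inj₁ fᵢ≡0 = fᵢ≡0
    ... | inj₂ fᵢ≡1 with unique zero (suc i) (≤-reflexive (sym f₀≡1)) (≤-reflexive (sym fᵢ≡1))
    ... | ()

∑-δ : ∀ {n} (x : Fin n) → ∑[ i < n ] δ i x ≡ 1
∑-δ {suc n} zero = cong suc (sum-replicate-zero n)
∑-δ (suc x)      = ∑-δ x

*-pos⇒ : ∀ m n → 0 < m * n → 0 < m × 0 < n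
*-pos⇒ (suc m) (suc n) _ = s≤s z≤n , s≤s z≤n
*-pos⇒ (suc m) zero    p = contradiction (subst (0 <_) (*-zeroʳ m) p) λ ()

rangeSum : ℕ → (ℕ → ℕ) → ℕ
rangeSum T ν = ∑[ c < T ] ν (toℕ c)

rangeSum-δ : ∀ T a (g : ℕ → ℕ) → a < T → rangeSum T (λ c → δℕ c a * g c) ≡ g a
rangeSum-δ (suc T) zero    g _ =
  trans (cong₂ _+_ (+-identityʳ (g 0)) (sum-replicate-zero T)) (+-identityʳ (g 0))
rangeSum-δ (suc T) (suc a) g (s≤s a<T) = rangeSum-δ T a (g ∘ suc) a<T

∑-by-label : ∀ {m} T (f α : Fin m → ℕ) (w : ℕ → ℕ) → (∀ e → α e < T) →
             rangeSum T (λ c → (∑[ e < m ] (f e * δℕ c (α e))) * w c) ≡ ∑[ e < m ] (f e * w (α e))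
∑-by-label {m} T f α w α<T = begin
    ∑[ c < T ] ((∑[ e < m ] (f e * δℕ (toℕ c) (α e))) * w (toℕ c))
  ≡⟨ sum-cong-≗ {T} (λ c → *-distribʳ-sum {m} (w (toℕ c)) _) ⟩
    ∑[ c < T ] ∑[ e < m ] (f e * δℕ (toℕ c) (α e) * w (toℕ c))
  ≡⟨ ∑-comm {T} {m} _ ⟩
    ∑[ e < m ] ∑[ c < T ] (f e * δℕ (toℕ c) (α e) * w (toℕ c))
  ≡⟨ sum-cong-≗ {m} (λ e → trans (sum-cong-≗ {T} (λ c → *-assoc (f e) _ _)) (sym (*-distribˡ-sum {T} (f e) _))) ⟩
    ∑[ e < m ] (f e * rangeSum T (λ c → δℕ c (α e) * w c))
  ≡⟨ sum-cong-≗ {m} (λ e → cong (f e *_) (rangeSum-δ T (α e) w (α<T e))) ⟩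
    ∑[ e < m ] (f e * w (α e))
  ∎

evenInd oddInd : ℕ → ℕ
evenInd zero    = 1
evenInd (suc n) = oddInd n
oddInd  zero    = 0
oddInd  (suc n) = evenInd n

evenInd+oddInd : ∀ n → evenInd n + oddInd n ≡ 1
evenInd+oddInd zero          = refl
evenInd+oddInd (suc zero)    = refl
evenInd+oddInd (suc (suc n)) = evenInd+oddInd n

double-even : ∀ x → 2 ∣ x + x
double-even x = divides x (trans (cong (x +_) (sym (+-identityʳ x))) (*-comm 2 x))

even⇒¬even-suc : ∀ {n} → 2 ∣ n → ¬ 2 ∣ suc n
even⇒¬even-suc {n} 2∣n 2∣1+n =
  contradiction (∣1⇒≡1 (∣m+n∣m⇒∣n (subst (2 ∣_) (+-comm 1 n) 2∣1+n) 2∣n)) λ ()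

Balanced : ℕ → ℕ → Set
Balanced x y = x ≤ suc y × y ≤ suc x

balanced-equal : ∀ {x y} → Balanced x y → 2 ∣ x + y → x ≡ y
balanced-equal {x} {y} (x≤1+y , y≤1+x) 2∣x+y with <-cmp x y
... | tri≈ _ x≡y _ = x≡y
... | tri< x<y _ _ =
  contradiction (subst (2 ∣_) (trans (cong (x +_) (≤-antisym y≤1+x x<y)) (+-suc x x)) 2∣x+y)
                (even⇒¬even-suc (double-even x))
... | tri> _ _ y<x =
  contradiction (subst (2 ∣_) (cong (_+ y) (≤-antisym x≤1+y y<x)) 2∣x+y)
                (even⇒¬even-suc (double-even y))

ZeroOne DownClosed Convex : (ℕ → ℕ) → Set
ZeroOne ν    = ∀ c → ν c ≤ 1
DownClosed ν = ∀ {a c} → 0 < ν a → c ≤ a → 0 < ν c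
Convex ν     = ∀ {a b c} → 0 < ν a → 0 < ν b → a ≤ c → c ≤ b → 0 < ν c

evenPart oddPart : ℕ → (ℕ → ℕ) → ℕ
evenPart T ν = rangeSum T (λ c → ν c * evenInd c)
oddPart  T ν = rangeSum T (λ c → ν c * oddInd c)

prefix-balance : ∀ T ν → ZeroOne ν → DownClosed ν →
                 oddPart T ν ≤ evenPart T ν × evenPart T ν ≤ suc (oddPart T ν)
prefix-balance zero    ν _        _    = z≤n , z≤n
prefix-balance (suc T) ν zero-one down with n≤1⇒n≡0∨n≡1 (zero-one 0)
... | inj₁ ν₀≡0 = ≤-reflexive (trans (vanishes oddInd) (sym (vanishes evenInd)))
                , ≤-trans (≤-reflexive (vanishes evenInd)) z≤n
  where
    ν≡0 : ∀ c → ν c ≡ 0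
    ν≡0 c = n≤0⇒n≡0 (≮⇒≥ λ νc-pos → n>0⇒n≢0 (down νc-pos z≤n) ν₀≡0)
    vanishes : ∀ w → rangeSum (suc T) (λ c → ν c * w c) ≡ 0
    vanishes w = ∑-zero {suc T} (λ c → cong (_* w (toℕ c)) (ν≡0 (toℕ c)))
... | inj₂ ν₀≡1 rewrite ν₀≡1 =
  let (odd≤even , even≤1+odd) = prefix-balance T (ν ∘ suc) (zero-one ∘ suc)
                                                 (λ p c≤a → down p (s≤s c≤a))
  in even≤1+odd , s≤s odd≤even

interval-balance : ∀ T ν → ZeroOne ν → Convex ν → Balanced (evenPart T ν) (oddPart T ν)
interval-balance zero    ν _        _      = z≤n , z≤n
interval-balance (suc T) ν zero-one convex with n≤1⇒n≡0∨n≡1 (zero-one 0)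
... | inj₁ ν₀≡0 rewrite ν₀≡0 =
  swap (interval-balance T (ν ∘ suc) (zero-one ∘ suc)
          (λ pa pb a≤c c≤b → convex pa pb (s≤s a≤c) (s≤s c≤b)))
... | inj₂ ν₀≡1 =
  let (odd≤even , even≤1+odd) = prefix-balance (suc T) ν zero-one
                                   (λ pa c≤a → convex (≤-reflexive (sym ν₀≡1)) pa z≤n c≤a)
  in even≤1+odd , m≤n⇒m≤1+n odd≤even

inc : (G : Multigraph) → Fin (nE G) → Fin (nV G) → ℕ
inc G e v = δ v (proj₁ (ends G e)) + δ v (proj₂ (ends G e))

deg : (G : Multigraph) → Fin (nV G) → ℕ
deg G v = ∑[ e < nE G ] inc G e v

inc≤1 : ∀ G → Loopless G → ∀ e v → inc G e v ≤ 1
inc≤1 G loopless e v with v Fin.≟ proj₁ (ends G e) | v Fin.≟ proj₂ (ends G e)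
... | yes v≡x | yes v≡y = contradiction (trans (sym v≡x) v≡y) (loopless e)
... | yes _   | no _    = ≤-refl
... | no _    | yes _   = ≤-refl
... | no _    | no _    = z≤n

inc-pos⇒incident : ∀ G e v → 0 < inc G e v → Incident G e v
inc-pos⇒incident G e v p with v Fin.≟ proj₁ (ends G e) | v Fin.≟ proj₂ (ends G e)
... | yes v≡x | _       = inj₁ (sym v≡x)
... | no _    | yes v≡y = inj₂ (sym v≡y)
... | no _    | no _    = contradiction p λ ()

incident⇒inc-pos : ∀ G e v → Incident G e v → 0 < inc G e v
incident⇒inc-pos G e v (inj₁ refl) =
  ≤-trans (≤-reflexive (sym (δ-refl v))) (m≤m+n _ (δ v (proj₂ (ends G e))))
incident⇒inc-pos G e v (inj₂ refl) =
  ≤-trans (≤-reflexive (sym (δ-refl v))) (m≤n+m _ (δ v (proj₁ (ends G e))))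

handshake : ∀ G (ω : Fin (nE G) → ℕ) →
            ∑[ v < nV G ] ∑[ e < nE G ] (inc G e v * ω e) ≡ 2 * ∑[ e < nE G ] ω e
handshake G ω = begin
    ∑[ v < nV G ] ∑[ e < nE G ] (inc G e v * ω e)
  ≡⟨ ∑-comm {nV G} {nE G} _ ⟩
    ∑[ e < nE G ] ∑[ v < nV G ] (inc G e v * ω e)
  ≡⟨ sum-cong-≗ {nE G} (λ e → sym (*-distribʳ-sum (ω e) (λ v → inc G e v))) ⟩
    ∑[ e < nE G ] ((∑[ v < nV G ] inc G e v) * ω e)
  ≡⟨ sum-cong-≗ {nE G} (λ e → cong (_* ω e) (two-ends e)) ⟩
    ∑[ e < nE G ] (2 * ω e)
  ≡⟨ sym (*-distribˡ-sum 2 ω) ⟩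
    2 * ∑[ e < nE G ] ω e
  ∎
  where
    two-ends : ∀ e → ∑[ v < nV G ] inc G e v ≡ 2
    two-ends e = trans (∑-distrib-+ (λ v → δ v x) (λ v → δ v y)) (cong₂ _+_ (∑-δ x) (∑-δ y))
      where x = proj₁ (ends G e) ; y = proj₂ (ends G e)

module AtVertex (G : Multigraph) (loopless : Loopless G) {t : ℕ} {α : Fin (nE G) → ℕ}
                (colouring : IsIntervalColoring G t α) (v : Fin (nV G)) where

  private
    proper : Proper G α
    proper = proj₁ colouring
    α<1+t : ∀ e → α e < suc t
    α<1+t e = s≤s (proj₂ (proj₁ (proj₂ colouring) e))
    interval : ∀ u a b c → InS G α u a → InS G α u b → a ≤ c → c ≤ b → InS G α u c
    interval = proj₂ (proj₂ (proj₂ colouring))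

  mult : ℕ → ℕ
  mult c = ∑[ e < nE G ] (inc G e v * δℕ c (α e))

  counted⇒ : ∀ {c e} → 0 < inc G e v * δℕ c (α e) → Incident G e v × α e ≡ c
  counted⇒ {c} {e} p =
    let (inc-pos , δ-pos) = *-pos⇒ (inc G e v) (δℕ c (α e)) p
    in inc-pos⇒incident G e v inc-pos , sym (δℕ-pos⇒≡ δ-pos)

  ⇒counted : ∀ {c e} → Incident G e v → α e ≡ c → 0 < inc G e v * δℕ c (α e)
  ⇒counted {e = e} e∋v refl =
    *-mono-≤ (incident⇒inc-pos G e v e∋v) (≤-reflexive (sym (δℕ-refl (α e))))

  mult-zero-one : ZeroOne mult
  mult-zero-one c = ∑≤1 {nE G} _ (λ e → *-mono-≤ (inc≤1 G loopless e v) (δℕ-≤1 c (α e))) same-edge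
    where
      same-edge : ∀ e f → 0 < inc G e v * δℕ c (α e) → 0 < inc G f v * δℕ c (α f) → e ≡ f
      same-edge e f p q with e Fin.≟ f
      ... | yes e≡f = e≡f
      ... | no  e≢f =
        let (e∋v , αe≡c) = counted⇒ {c} p ; (f∋v , αf≡c) = counted⇒ {c} q
        in contradiction (trans αe≡c (sym αf≡c)) (proper e f v e≢f e∋v f∋v)

  mult-pos⇒InS : ∀ c → 0 < mult c → InS G α v c
  mult-pos⇒InS c p = let (e , q) = ∑-pos {nE G} _ p in e , counted⇒ q

  InS⇒mult-pos : ∀ c → InS G α v c → 0 < mult c
  InS⇒mult-pos c (e , e∋v , αe≡c) = ≤-trans (⇒counted e∋v αe≡c) (term≤∑ {nE G} _ e)

  mult-convex : Convex mult
  mult-convex pa pb a≤c c≤b =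
    InS⇒mult-pos _ (interval v _ _ _ (mult-pos⇒InS _ pa) (mult-pos⇒InS _ pb) a≤c c≤b)

  evenAt oddAt : ℕ
  evenAt = ∑[ e < nE G ] (inc G e v * evenInd (α e))
  oddAt  = ∑[ e < nE G ] (inc G e v * oddInd (α e))

  evenAt+oddAt : evenAt + oddAt ≡ deg G v
  evenAt+oddAt = trans (sym (∑-distrib-+ {nE G} _ _)) (sum-cong-≗ {nE G} split)
    where
      split : ∀ e → inc G e v * evenInd (α e) + inc G e v * oddInd (α e) ≡ inc G e v
      split e = begin
          inc G e v * evenInd (α e) + inc G e v * oddInd (α e)
        ≡⟨ sym (*-distribˡ-+ (inc G e v) _ _) ⟩
          inc G e v * (evenInd (α e) + oddInd (α e))
        ≡⟨ cong (inc G e v *_) (evenInd+oddInd (α e)) ⟩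
          inc G e v * 1
        ≡⟨ *-identityʳ _ ⟩
          inc G e v
        ∎

  -- Regrouping by colour turns interval-balance into a statement about evenAt, oddAt.
  evenAt-balanced : Balanced evenAt oddAt
  evenAt-balanced =
    subst₂ Balanced (by-colour evenInd) (by-colour oddInd)
      (interval-balance (suc t) mult mult-zero-one mult-convex)
    where
      by-colour : ∀ w → rangeSum (suc t) (λ c → mult c * w c) ≡ ∑[ e < nE G ] (inc G e v * w (α e))
      by-colour w = ∑-by-label (suc t) (λ e → inc G e v) α w α<1+t

  evenAt≡oddAt : 2 ∣ deg G v → evenAt ≡ oddAt
  evenAt≡oddAt 2∣deg = balanced-equal evenAt-balanced (subst (2 ∣_) (sym evenAt+oddAt) 2∣deg)

even-degrees⇒even-size : ∀ G → Loopless G → ∀ {t α} → IsIntervalColoring G t α →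
                         (∀ v → 2 ∣ deg G v) → 2 ∣ nE G
even-degrees⇒even-size G loopless {α = α} colouring even-deg =
  subst (2 ∣_) edges≡ (double-even X)
  where
    module At = AtVertex G loopless colouring
    X Y : ℕ
    X = ∑[ e < nE G ] evenInd (α e)
    Y = ∑[ e < nE G ] oddInd (α e)
    X≡Y : X ≡ Y
    X≡Y = *-cancelˡ-≡ X Y 2 (begin
        2 * X                     ≡⟨ sym (handshake G (evenInd ∘ α)) ⟩
        ∑[ v < nV G ] At.evenAt v ≡⟨ sum-cong-≗ {nV G} (λ v → At.evenAt≡oddAt v (even-deg v)) ⟩
        ∑[ v < nV G ] At.oddAt v  ≡⟨ handshake G (oddInd ∘ α) ⟩
        2 * Y                     ∎)
    edges≡ : X + X ≡ nE G
    edges≡ = begin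
        X + X                                          ≡⟨ cong (X +_) X≡Y ⟩
        X + Y                                          ≡⟨ sym (∑-distrib-+ {nE G} _ _) ⟩
        ∑[ e < nE G ] (evenInd (α e) + oddInd (α e))   ≡⟨ sum-cong-≗ {nE G} (evenInd+oddInd ∘ α) ⟩
        ∑[ e < nE G ] 1                                ≡⟨ ∑-ones (nE G) ⟩
        nE G                                           ∎

-- An injective endomap of Fin n is surjective: a missed value would give an
-- injection Fin n → Fin (n - 1).
injective⇒surjective : ∀ {n} {σ : Fin n → Fin n} → Injective _≡_ _≡_ σ → ∀ j → ∃ λ i → σ i ≡ j
injective⇒surjective {suc n} {σ} σ-inj j with any? (λ i → σ i Fin.≟ j)
... | yes hit  = hit
... | no  miss = contradiction (injective⇒≤ squeeze-inj) 1+n≰n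
  where
    avoids : ∀ i → j ≢ σ i
    avoids i j≡σi = miss (i , sym j≡σi)
    squeeze : Fin (suc n) → Fin n
    squeeze i = punchOut (avoids i)
    squeeze-inj : Injective _≡_ _≡_ squeeze
    squeeze-inj {a} {b} eq = σ-inj (punchOut-injective (avoids a) (avoids b) eq)

∑-reindex : ∀ {n} {σ : Fin n → Fin n} → Injective _≡_ _≡_ σ →
            ∀ (f : Fin n → ℕ) → sum f ≡ ∑[ i < n ] f (σ i)
∑-reindex {n} {σ} σ-inj f =
  ∑-permute f (permutation σ σ⁻¹ (λ j → proj₂ (onto j)) (λ i → σ-inj (proj₂ (onto (σ i)))))
  where
    onto : ∀ j → ∃ λ i → σ i ≡ j
    onto = injective⇒surjective σ-inj
    σ⁻¹ : Fin n → Fin n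
    σ⁻¹ j = proj₁ (onto j)

∑-rotate : ∀ {m} (g : Fin (suc m) → ℕ) → g zero ≡ g (fromℕ m) →
           ∑[ i < m ] g (suc i) ≡ ∑[ i < m ] g (inject₁ i)
∑-rotate {m} g closed = +-cancelˡ-≡ (g zero) _ _ (begin
    g zero + ∑[ i < m ] g (suc i)        ≡⟨ sum-init-last g ⟩
    ∑[ i < m ] g (inject₁ i) + g (fromℕ m) ≡⟨ +-comm _ (g (fromℕ m)) ⟩
    g (fromℕ m) + ∑[ i < m ] g (inject₁ i) ≡⟨ cong (_+ ∑[ i < m ] g (inject₁ i)) (sym closed) ⟩
    g zero + ∑[ i < m ] g (inject₁ i)      ∎)

-- A closed trail through every edge leaves each vertex as often as it enters.
eulerian⇒even-degrees : ∀ G → Eulerian G → ∀ w → 2 ∣ deg G w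
eulerian⇒even-degrees G (σ , v , σ-inj , closed , joins) w = subst (2 ∣_) degree≡ (double-even A)
  where
    m : ℕ
    m = nE G
    -- A counts the departures of the trail from w, which equal its arrivals.
    A : ℕ
    A = ∑[ i < m ] δ w (v (inject₁ i))
    step : ∀ i → inc G (σ i) w ≡ δ w (v (inject₁ i)) + δ w (v (suc i))
    step i with joins i
    ... | inj₁ ends≡ rewrite ends≡ = refl
    ... | inj₂ ends≡ rewrite ends≡ = +-comm (δ w (v (suc i))) _
    degree≡ : A + A ≡ deg G w
    degree≡ = begin
        A + A                                              ≡⟨ cong (A +_) (sym (∑-rotate (δ w ∘ v) (cong (δ w) closed))) ⟩
        A + ∑[ i < m ] δ w (v (suc i))                     ≡⟨ sym (∑-distrib-+ {m} _ _) ⟩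
        ∑[ i < m ] (δ w (v (inject₁ i)) + δ w (v (suc i))) ≡⟨ sum-cong-≗ {m} (sym ∘ step) ⟩
        ∑[ i < m ] inc G (σ i) w                           ≡⟨ sym (∑-reindex σ-inj (λ e → inc G e w)) ⟩
        deg G w                                            ∎

module Subdivision (G : Multigraph) (e : Fin (nE G)) where

  private
    Gₑ : Multigraph
    Gₑ = subdivide G e
    y₂ : Fin (nV G)
    y₂ = proj₂ (ends G e)

  loopless : Loopless G → Loopless Gₑ
  loopless _  zero = λ ()
  loopless ll (suc i) with i Fin.≟ e
  ... | yes _ = λ ()
  ... | no  _ = λ ends≡ → ll i (suc-injective ends≡)

  inc-new-vertex : ∀ i → inc Gₑ (suc i) zero ≡ δ i e
  inc-new-vertex i with i Fin.≟ e
  ... | yes _ = refl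
  ... | no  _ = refl

  -- An old vertex keeps its incidences, except that the second end of e is
  -- now an end of the new edge.
  inc-old-vertex : ∀ i y → inc Gₑ (suc i) (suc y) + δ i e * δ y y₂ ≡ inc G i y
  inc-old-vertex i y with i Fin.≟ e
  ... | yes refl = cong₂ _+_ (+-identityʳ (δ y (proj₁ (ends G e)))) (+-identityʳ (δ y y₂))
  ... | no  _    = +-identityʳ _

  deg-new-vertex : deg Gₑ zero ≡ 2
  deg-new-vertex = cong suc (trans (sum-cong-≗ {nE G} inc-new-vertex) (∑-δ e))

  deg-old-vertex : ∀ y → deg Gₑ (suc y) ≡ deg G y
  deg-old-vertex y = begin
      δ y y₂ + rest
    ≡⟨ +-comm (δ y y₂) rest ⟩
      rest + δ y y₂
    ≡⟨ cong (rest +_) (sym moved) ⟩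
      rest + ∑[ i < nE G ] (δ i e * δ y y₂)
    ≡⟨ sym (∑-distrib-+ {nE G} _ _) ⟩
      ∑[ i < nE G ] (inc Gₑ (suc i) (suc y) + δ i e * δ y y₂)
    ≡⟨ sum-cong-≗ {nE G} (λ i → inc-old-vertex i y) ⟩
      deg G y
    ∎
    where
      rest : ℕ
      rest = ∑[ i < nE G ] inc Gₑ (suc i) (suc y)
      -- the incidence of y with e is carried by the new edge
      moved : ∑[ i < nE G ] (δ i e * δ y y₂) ≡ δ y y₂
      moved = trans (sym (*-distribʳ-sum (δ y y₂) (λ i → δ i e)))
                    (trans (cong (_* δ y y₂) (∑-δ e)) (*-identityˡ _))

  even-degrees : (∀ v → 2 ∣ deg G v) → ∀ v → 2 ∣ deg Gₑ v
  even-degrees _    zero    = subst (2 ∣_) (sym deg-new-vertex) ∣-refl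
  even-degrees even (suc y) = subst (2 ∣_) (sym (deg-old-vertex y)) (even y)

corollary3 : (G : Multigraph) → Loopless G → Eulerian G → IntervalColorable G →
    (e : Fin (nE G)) → ¬ IntervalColorable (subdivide G e)
corollary3 G loopless eulerian (_ , _ , _ , colouring) e (_ , _ , _ , colouringₑ) =
  even⇒¬even-suc even-size even-sizeₑ
  where
    even-deg : ∀ v → 2 ∣ deg G v
    even-deg = eulerian⇒even-degrees G eulerian
    even-size : 2 ∣ nE G
    even-size = even-degrees⇒even-size G loopless colouring even-deg
    even-sizeₑ : 2 ∣ suc (nE G)
    even-sizeₑ = even-degrees⇒even-size (subdivide G e) (Subdivision.loopless G e loopless)
                   colouringₑ (Subdivision.even-degrees G e even-deg)
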